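{- Let $0<e_0\le1$ and $1\le m_1\le m-1$. For every instance of $P_m, e_{i\le m_1,k}\ge e_0\mid\mid C_{\max}$, the makespan $C_{\max}(\text{LS-ECT})$ of any LS-ECT schedule satisfies $$\frac{C_{\max}(\text{LS-ECT})}{C^*_{\max}}\le 1+\frac{1}{e_0}\left(\left\lfloor\frac{m-1}{m_1}\right\rfloor+1\right),$$ where $C^*_{\max}$ is the optimal makespan.
   Context: Shared-processing scheduling model: $m$ identical parallel machines $M_1,\dots,M_m$; $n$ primary jobs available at time $0$, job $j$ with processing time $p_j>0$, each processed without interruption on one machine. The time axis of each $M_i$ is partitioned into consecutive intervals $(0,t_{i,1}],(t_{i,1},t_{i,2}],\dots$ with sharing ratios $e_{i,1},e_{i,2},\dots\in(0,1]$; during an interval with ratio $e$ a primary job on that machine receives $e$ units of processing per unit of time. Jobs on a machine are processed consecutively; a job with processing time $p$ started at time $s$ on $M_i$ completes at the earliest $C$ with $\int_s^C e_i(t)dt=p$. Makespan $C_{\max}=\max_j C_j$. The problem $P_m, e_{i\le m_1,k}\ge e_0\mid\mid C_{\max}$ is makespan minimization where all sharing ratios on machines $M_1,\dots,M_{m_1}$ are at least $e_0$, while those on $M_{m_1+1},\dots,M_m$ are arbitrary in $(0,1]$. LS-ECT: given an ordered list of the jobs (arbitrary), the jobs are taken one by one in list order and each is appended at the end of the machine on which it would complete earliest.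
   Formalization: The processing times $p_j$, the interval endpoints and sharing ratios of every machine, and $e_0$ are rational. -}

module Defs where

open import Data.Nat as ℕ using (ℕ; zero; suc)
open import Data.Nat.DivMod as ℕD using ()
open import Data.Integer as ℤ using (+_)
open import Data.Rational as ℚ using (ℚ; 0ℚ; 1ℚ; _+_; _*_; _-_; _≤_; _<_; _⊓_; _⊔_; 1/_; Positive; NonZero; positive)
open import Data.Rational.Properties using (pos⇒nonZero)
open import Data.Fin using (Fin; toℕ; _≟_) renaming (zero to fzero; suc to fsuc)
open import Data.List using (List; []; _∷_; concat; map; allFin)
open import Data.List.Relation.Binary.Permutation.Propositional using (_↭_)
open import Data.Product using (Σ; ∃; _×_; _,_)
open import Relation.Binary.PropositionalEquality using (_≡_)
open import Relation.Nullary using (yes; no)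

ℕtoℚ : ℕ → ℚ
ℕtoℚ k = (+ k) ℚ./ 1

-- Sharing-ratio profile of one machine.
-- Intervals (t 0, t 1], (t 1, t 2], ... with t 0 = 0; during interval
-- (t k, t (k+1)] the sharing ratio is e k.
record Profile : Set where
  field
    t       : ℕ → ℚ
    e       : ℕ → ℚ
    t0      : t 0 ≡ 0ℚ
    t-incr  : ∀ k → t k < t (suc k)
    t-unbdd : ∀ (T : ℚ) → ∃ λ k → T < t k
    e-pos   : ∀ k → 0ℚ < e k
    e-le1   : ∀ k → e k ≤ 1ℚ
open Profile public

workUpto : Profile → ℕ → ℚ → ℚ
workUpto P zero    T = 0ℚ
workUpto P (suc K) T =
  workUpto P K T + e P K * ((T ⊓ t P (suc K)) - (T ⊓ t P K))

-- Work P T w : the integral ∫_0^T e(t) dt equals w  (for T ≥ 0)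
Work : Profile → ℚ → ℚ → Set
Work P T w = Σ ℕ λ K → (T ≤ t P K) × (workUpto P K T ≡ w)

-- Completes P s p C : a job of processing time p started at time s on a
-- machine with profile P completes at time C, i.e. C is the earliest
-- time with ∫_s^C e(t) dt = p.
Completes : Profile → ℚ → ℚ → ℚ → Set
Completes P s p C =
  (s ≤ C) ×
  Σ ℚ λ ws → Σ ℚ λ wc → Work P s ws × Work P C wc × (wc ≡ ws + p) ×
    (∀ C' w' → s ≤ C' → Work P C' w' → ws + p ≤ w' → C ≤ C')

-- maximum over finitely many values (all values considered are ≥ 0)
maxOver : ∀ {m} → (Fin m → ℚ) → ℚ
maxOver {zero}  f = 0ℚ
maxOver {suc m} f = f fzero ⊔ maxOver {m} (λ i → f (fsuc i))

update : ∀ {m} → (Fin m → ℚ) → Fin m → ℚ → (Fin m → ℚ)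
update f i x j with j ≟ i
... | yes _ = x
... | no  _ = f j

data RunSeq {n : ℕ} (P : Profile) (p : Fin n → ℚ) : ℚ → List (Fin n) → ℚ → Set where
  run-[] : ∀ {s} → RunSeq P p s [] s
  run-∷  : ∀ {s c F j js} → Completes P s (p j) c → RunSeq P p c js F →
           RunSeq P p s (j ∷ js) F

IsSchedule : ∀ {m n} → (Fin m → List (Fin n)) → Set
IsSchedule {m} {n} σ = concat (map σ (allFin m)) ↭ allFin n

-- LSECT P p F L F' : starting from machine finishing times F,
-- processing the job list L in order, each job appended to a machine on
-- which it completes earliest (ties broken arbitrarily), the final
-- machine finishing times are F'.
data LSECT {m n : ℕ} (P : Fin m → Profile) (p : Fin n → ℚ) :
           (Fin m → ℚ) → List (Fin n) → (Fin m → ℚ) → Set where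
  ls-[] : ∀ {F} → LSECT P p F [] F
  ls-∷  : ∀ {F F' j js} (c : Fin m → ℚ) →
          (∀ i → Completes (P i) (F i) (p j) (c i)) →
          (i : Fin m) → (∀ i' → c i ≤ c i') →
          LSECT P p (update F i (c i)) js F' →
          LSECT P p F (j ∷ js) F'

bound : (e0 : ℚ) → .{{NonZero e0}} → (m m1 : ℕ) → .{{ℕ.NonZero m1}} → ℚ
bound e0 m m1 = 1ℚ + (1/ e0) * ℕtoℚ (((m ℕ.∸ 1) ℕ./ m1) ℕ.+ 1)

{-# OPTIONS --safe #-}
module Submission where

-- Let W_i(T) = ∫₀ᵀ e_i (processed (P i) T) be the work machine i can do by time T, and D the
-- makespan of a feasible schedule (e.g. an optimal one).  Then every p_j ≤ D and
-- Σ_j p_j ≤ Σ_i W_i(D), and LS-ECT maintains "work already done + work still to be assigned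
-- ≤ Σ_i W_i(D)".  Put K = ⌊(m-1)/m1⌋ + 1 and X = (1 + K/e0)·D.  If a job j were completed
-- after X, it would complete after X on every machine.  Each of the m1 fast machines runs at
-- rate ≥ e0 after D, so it would already have done at least W_i(D) + K·D − p_j ≥ W_i(D) + (K−1)·D,
-- and every machine has done at least W_i(D) − D.  Since m ≤ m1·K, the work done would be at
-- least Σ_i W_i(D), leaving no room for p_j > 0.

open import Defs
open import Data.Nat as ℕ using (ℕ)
open import Data.Rational using (ℚ; 0ℚ; 1ℚ; _*_; _≤_; _<_; positive)
open import Data.Rational.Properties using (pos⇒nonZero)
open import Data.Fin using (Fin; toℕ)
open import Data.List using (List; allFin)
open import Data.List.Relation.Binary.Permutation.Propositional using (_↭_)

open import Level using (0ℓ)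
open import Function using (_∘_)
open import Data.Product using (∃; _,_; proj₁; proj₂)
open import Data.Empty using (⊥-elim)
open import Data.Sum using (inj₁; inj₂)
open import Relation.Nullary using (yes; no)
open import Relation.Nullary.Decidable using (dec⇒maybe)
open import Relation.Binary.PropositionalEquality
  using (_≡_; _≢_; refl; sym; trans; cong; cong₂; subst; subst₂; module ≡-Reasoning)
open import Data.Nat using (zero; suc; s≤s; _≤′_; ≤′-refl; ≤′-step)
import Data.Nat.Properties as ℕ
import Data.Nat.DivMod as ℕ
import Data.Nat.Tactic.RingSolver as ℕ-Solver
import Data.Integer as ℤ
import Data.Integer.Properties as ℤ
open import Data.Nat.Coprimality using (1-coprimeTo) renaming (sym to coprime-sym)
open import Data.Rational using (_+_; _-_; -_; _⊓_; _⊔_; _/_; 1/_; mkℚ; nonNegative; Positive; NonZero)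
open import Data.Rational.Properties
open import Data.Fin using (punchIn) renaming (zero to fzero; suc to fsuc)
import Data.Fin as Fin
open import Data.Fin.Properties using (punchInᵢ≢i)
open import Data.List using ([]; _∷_; _++_; foldr; map; concat; tabulate)
open import Data.List.Properties using (map-++; map-tabulate)
open import Data.List.Membership.Propositional using (_∈_)
open import Data.List.Membership.Propositional.Properties using (∈-allFin; ∈-concat⁻′; ∈-map⁻)
open import Data.List.Relation.Unary.Any using (here; there)
open import Data.List.Relation.Binary.Permutation.Propositional using (↭⇒↭ₛ; ↭-sym; ↭-trans)
open import Data.List.Relation.Binary.Permutation.Propositional.Properties using (∈-resp-↭; map⁺)
open import Data.List.Relation.Binary.Permutation.Setoid.Properties using (foldr-commMonoid)
open import Algebra.Bundles using (CommutativeMonoid)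
open import Algebra.Properties.CommutativeMonoid.Sum +-0-commutativeMonoid
  using (sum; sum-cong-≗; sum-remove; sum-replicate; sum-replicate-zero; ∑-distrib-+)
open import Algebra.Properties.Monoid.Mult +-0-monoid using (_×_; ×-assocˡ)
open import Tactic.RingSolver using (solve-∀)
open import Tactic.RingSolver.Core.AlmostCommutativeRing using (AlmostCommutativeRing; fromCommutativeRing)

ℚ-ring : AlmostCommutativeRing 0ℓ 0ℓ
ℚ-ring = fromCommutativeRing +-*-commutativeRing (λ x → dec⇒maybe (0ℚ ≟ x))

x≤x+y : ∀ x {y} → 0ℚ ≤ y → x ≤ x + y
x≤x+y x {y} 0≤y = subst (_≤ x + y) (+-identityʳ x) (+-monoʳ-≤ x 0≤y)

x≤y+x : ∀ x {y} → 0ℚ ≤ y → x ≤ y + x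
x≤y+x x {y} 0≤y = subst (_≤ y + x) (+-identityˡ x) (+-monoˡ-≤ x 0≤y)

x<x+y : ∀ x {y} → 0ℚ < y → x < x + y
x<x+y x {y} 0<y = subst (_< x + y) (+-identityʳ x) (+-monoʳ-< x 0<y)

p≤q⇒0≤q-p : ∀ {p q} → p ≤ q → 0ℚ ≤ q - p
p≤q⇒0≤q-p {p} {q} p≤q = subst (_≤ q - p) (+-inverseʳ p) (+-monoˡ-≤ (- p) p≤q)

+-cancelʳ-≤ : ∀ x {y z} → y + x ≤ z + x → y ≤ z
+-cancelʳ-≤ x {y} {z} y+x≤z+x = subst₂ _≤_ (cancel y x) (cancel z x) (+-monoˡ-≤ (- x) y+x≤z+x)
  where
  cancel : ∀ w v → w + v - v ≡ w
  cancel = solve-∀ ℚ-ring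

⊓-increment-clamp : ∀ {u v} x → v ≤ u → x ⊓ u - x ⊓ v ≡ (x ⊓ u) ⊔ v - v
⊓-increment-clamp {u} {v} x v≤u with ≤-total x v
... | inj₁ x≤v = begin
  x ⊓ u - x ⊓ v      ≡⟨ cong₂ _-_ (p≤q⇒p⊓q≡p (≤-trans x≤v v≤u)) (p≤q⇒p⊓q≡p x≤v) ⟩
  x - x              ≡⟨ trans (+-inverseʳ x) (sym (+-inverseʳ v)) ⟩
  v - v              ≡⟨ cong (_- v) (p≤q⇒p⊔q≡q (≤-trans (p⊓q≤p x u) x≤v)) ⟨
  (x ⊓ u) ⊔ v - v    ∎
  where open ≡-Reasoning
... | inj₂ v≤x = cong₂ _-_ (sym (p≥q⇒p⊔q≡p (⊓-glb v≤x v≤u))) (p≥q⇒p⊓q≡q v≤x)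

m≤n*[[m∸1]/n+1] : ∀ m n .{{_ : ℕ.NonZero n}} → m ℕ.≤ n ℕ.* ((m ℕ.∸ 1) ℕ./ n ℕ.+ 1)
m≤n*[[m∸1]/n+1] m n = begin
  m                                  ≤⟨ ℕ.m≤n+m∸n m 1 ⟩
  suc (m ℕ.∸ 1)                      ≡⟨ cong suc (ℕ.m≡m%n+[m/n]*n (m ℕ.∸ 1) n) ⟩
  suc ((m ℕ.∸ 1) ℕ.% n ℕ.+ q ℕ.* n)  ≤⟨ ℕ.+-monoˡ-≤ (q ℕ.* n) (ℕ.m%n<n (m ℕ.∸ 1) n) ⟩
  n ℕ.+ q ℕ.* n                      ≡⟨ rearrange n q ⟩
  n ℕ.* (q ℕ.+ 1)                    ∎
  where
  open ℕ.≤-Reasoning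
  q : ℕ
  q = (m ℕ.∸ 1) ℕ./ n
  rearrange : ∀ n q → n ℕ.+ q ℕ.* n ≡ n ℕ.* (q ℕ.+ 1)
  rearrange = ℕ-Solver.solve-∀

ℕtoℚ-suc : ∀ k → ℕtoℚ (suc k) ≡ 1ℚ + ℕtoℚ k
ℕtoℚ-suc k = begin
  ℤ.+ suc k / 1                              ≡⟨ cong (λ z → (ℤ.+ 1 ℤ.+ z) / 1) (ℤ.*-identityʳ (ℤ.+ k)) ⟨
  (ℤ.+ 1 ℤ.* ℤ.+ 1 ℤ.+ ℤ.+ k ℤ.* ℤ.+ 1) / 1  ≡⟨⟩
  1ℚ + k/1                                   ≡⟨ cong (1ℚ +_) (↥p/↧p≡p k/1) ⟨
  1ℚ + ℕtoℚ k                                ∎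
  where
  open ≡-Reasoning
  k/1 : ℚ
  k/1 = mkℚ (ℤ.+ k) 0 (coprime-sym (1-coprimeTo k))

ℕtoℚ*≡× : ∀ k x → ℕtoℚ k * x ≡ k × x
ℕtoℚ*≡× zero    x = *-zeroˡ x
ℕtoℚ*≡× (suc k) x = begin
  ℕtoℚ (suc k) * x     ≡⟨ cong (_* x) (ℕtoℚ-suc k) ⟩
  (1ℚ + ℕtoℚ k) * x    ≡⟨ *-distribʳ-+ x 1ℚ (ℕtoℚ k) ⟩
  1ℚ * x + ℕtoℚ k * x  ≡⟨ cong₂ _+_ (*-identityˡ x) (ℕtoℚ*≡× k x) ⟩
  x + k × x            ∎
  where open ≡-Reasoning

×-nonneg : ∀ k {x} → 0ℚ ≤ x → 0ℚ ≤ k × x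
×-nonneg zero        0≤x = ≤-refl
×-nonneg (suc k) {x} 0≤x = ≤-trans (×-nonneg k 0≤x) (x≤y+x (k × x) 0≤x)

×-monoˡ-≤ : ∀ {k l x} → k ℕ.≤ l → 0ℚ ≤ x → k × x ≤ l × x
×-monoˡ-≤ {l = l} ℕ.z≤n       0≤x = ×-nonneg l 0≤x
×-monoˡ-≤ {x = x} (s≤s k≤l) 0≤x = +-monoʳ-≤ x (×-monoˡ-≤ k≤l 0≤x)

sum-mono : ∀ {m} {f g : Fin m → ℚ} → (∀ i → f i ≤ g i) → sum f ≤ sum g
sum-mono {zero}  f≤g = ≤-refl
sum-mono {suc m} f≤g = +-mono-≤ (f≤g fzero) (sum-mono (f≤g ∘ fsuc))

sum-count : ∀ {m} k {f g : Fin m → ℚ} {x} → k ℕ.≤ m → (∀ i → f i ≤ g i) →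
            (∀ i → toℕ i ℕ.< k → f i + x ≤ g i) → sum f + k × x ≤ sum g
sum-count zero {f} _ f≤g _ = subst (_≤ _) (sym (+-identityʳ (sum f))) (sum-mono f≤g)
sum-count {suc m} (suc k) {f} {g} {x} (s≤s k≤m) f≤g f+x≤g = begin
  (f fzero + sum (f ∘ fsuc)) + (x + k × x)  ≡⟨ interchange (f fzero) (sum (f ∘ fsuc)) x (k × x) ⟩
  (f fzero + x) + (sum (f ∘ fsuc) + k × x)  ≤⟨ +-mono-≤ (f+x≤g fzero (s≤s ℕ.z≤n)) tail-count ⟩
  g fzero + sum (g ∘ fsuc)                  ∎
  where
  open ≤-Reasoning
  interchange : ∀ a b c d → (a + b) + (c + d) ≡ (a + c) + (b + d)
  interchange = solve-∀ ℚ-ring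
  tail-count : sum (f ∘ fsuc) + k × x ≤ sum (g ∘ fsuc)
  tail-count = sum-count k k≤m (f≤g ∘ fsuc) (λ i i<k → f+x≤g (fsuc i) (s≤s i<k))

sum-bump : ∀ {m} {f g : Fin m → ℚ} i {d} → g i ≡ f i + d → (∀ j → j ≢ i → g j ≡ f j) →
           sum g ≡ sum f + d
sum-bump {suc m} {f} {g} i {d} gi≡fi+d g≡f = begin
  sum g                              ≡⟨ sum-remove g ⟩
  g i + sum (g ∘ punchIn i)          ≡⟨ cong₂ _+_ gi≡fi+d (sum-cong-≗ (λ j → g≡f _ (punchInᵢ≢i i j))) ⟩
  (f i + d) + sum (f ∘ punchIn i)    ≡⟨ swap (f i) d (sum (f ∘ punchIn i)) ⟩
  (f i + sum (f ∘ punchIn i)) + d    ≡⟨ cong (_+ d) (sum-remove f) ⟨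
  sum f + d                          ∎
  where
  open ≡-Reasoning
  swap : ∀ a b c → (a + b) + c ≡ (a + c) + b
  swap = solve-∀ ℚ-ring

listSum : List ℚ → ℚ
listSum = foldr _+_ 0ℚ

listSum-++ : ∀ xs ys → listSum (xs ++ ys) ≡ listSum xs + listSum ys
listSum-++ []       ys = sym (+-identityˡ (listSum ys))
listSum-++ (x ∷ xs) ys = trans (cong (x +_) (listSum-++ xs ys)) (sym (+-assoc x (listSum xs) (listSum ys)))

listSum-↭ : ∀ {xs ys} → xs ↭ ys → listSum xs ≡ listSum ys
listSum-↭ xs↭ys = foldr-commMonoid ℚ-+-0.setoid ℚ-+-0.isCommutativeMonoid (↭⇒↭ₛ xs↭ys)
  where module ℚ-+-0 = CommutativeMonoid +-0-commutativeMonoid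

module _ {A : Set} (f : A → ℚ) where

  listSum-map-concat : ∀ {m} (τ : Fin m → List A) →
                       listSum (map f (concat (tabulate τ))) ≡ sum (λ i → listSum (map f (τ i)))
  listSum-map-concat {zero}  τ = refl
  listSum-map-concat {suc m} τ = begin
    listSum (map f (τ fzero ++ concat (tabulate (τ ∘ fsuc))))
      ≡⟨ cong listSum (map-++ f (τ fzero) (concat (tabulate (τ ∘ fsuc)))) ⟩
    listSum (map f (τ fzero) ++ map f (concat (tabulate (τ ∘ fsuc))))
      ≡⟨ listSum-++ (map f (τ fzero)) _ ⟩
    listSum (map f (τ fzero)) + listSum (map f (concat (tabulate (τ ∘ fsuc))))
      ≡⟨ cong (listSum (map f (τ fzero)) +_) (listSum-map-concat (τ ∘ fsuc)) ⟩
    sum (λ i → listSum (map f (τ i)))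
      ∎
    where open ≡-Reasoning

  module _ (f-nonneg : ∀ x → 0ℚ ≤ f x) where

    listSum-nonneg : ∀ xs → 0ℚ ≤ listSum (map f xs)
    listSum-nonneg []       = ≤-refl
    listSum-nonneg (x ∷ xs) = ≤-trans (listSum-nonneg xs) (x≤y+x _ (f-nonneg x))

    ∈⇒≤-listSum : ∀ {x xs} → x ∈ xs → f x ≤ listSum (map f xs)
    ∈⇒≤-listSum {x} {_ ∷ xs}  (here refl)  = x≤x+y (f x) (listSum-nonneg xs)
    ∈⇒≤-listSum {xs = y ∷ xs} (there x∈xs) = ≤-trans (∈⇒≤-listSum x∈xs) (x≤y+x _ (f-nonneg y))

maxOver-nonneg : ∀ {m} (f : Fin m → ℚ) → 0ℚ ≤ maxOver f
maxOver-nonneg {zero}  f = ≤-refl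
maxOver-nonneg {suc m} f = ≤-trans (maxOver-nonneg (f ∘ fsuc)) (p≤q⊔p (f fzero) _)

maxOver-ub : ∀ {m} (f : Fin m → ℚ) i → f i ≤ maxOver f
maxOver-ub {suc m} f fzero    = p≤p⊔q _ _
maxOver-ub {suc m} f (fsuc i) = ≤-trans (maxOver-ub (f ∘ fsuc) i) (p≤q⊔p (f fzero) _)

maxOver-lub : ∀ {m} (f : Fin m → ℚ) {X} → 0ℚ ≤ X → (∀ i → f i ≤ X) → maxOver f ≤ X
maxOver-lub {zero}  f 0≤X f≤X = 0≤X
maxOver-lub {suc m} f 0≤X f≤X = ⊔-lub (f≤X fzero) (maxOver-lub (f ∘ fsuc) 0≤X (f≤X ∘ fsuc))

module _ {m} (f : Fin m → ℚ) (i : Fin m) (x : ℚ) where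

  update-≡ : update f i x i ≡ x
  update-≡ with i Fin.≟ i
  ... | yes _  = refl
  ... | no i≢i = ⊥-elim (i≢i refl)

  update-≢ : ∀ {j} → j ≢ i → update f i x j ≡ f j
  update-≢ {j} j≢i with j Fin.≟ i
  ... | yes j≡i = ⊥-elim (j≢i j≡i)
  ... | no _    = refl

  update-pointwise : (Q : ℚ → Set) → Q x → (∀ j → Q (f j)) → ∀ j → Q (update f i x j)
  update-pointwise Q Qx Qf j with j Fin.≟ i
  ... | yes _ = Qx
  ... | no _  = Qf j

∈-schedule : ∀ {m n} {σ : Fin m → List (Fin n)} → IsSchedule σ → ∀ j → ∃ λ i → j ∈ σ i
∈-schedule {m} {σ = σ} schedule j
  with xs , j∈xs , xs∈σs ← ∈-concat⁻′ (map σ (allFin m)) (∈-resp-↭ (↭-sym schedule) (∈-allFin j))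
  with i , _ , refl ← ∈-map⁻ σ xs∈σs
  = i , j∈xs

module WorkFunction (P : Profile) where

  t-mono : ∀ {k l} → k ≤′ l → t P k ≤ t P l
  t-mono ≤′-refl       = ≤-refl
  t-mono (≤′-step k≤l) = ≤-trans (t-mono k≤l) (<⇒≤ (t-incr P _))

  0≤t : ∀ k → 0ℚ ≤ t P k
  0≤t k = subst (_≤ t P k) (t0 P) (t-mono ℕ.z≤′n)

  -- the length of (0, T] ∩ (t k, t (k+1)]; workUpto P (suc K) T unfolds to
  -- workUpto P K T + e P K * covered K T
  covered : ℕ → ℚ → ℚ
  covered k T = T ⊓ t P (suc k) - T ⊓ t P k

  covered-mono : ∀ k {a b} → a ≤ b → covered k a ≤ covered k b
  covered-mono k {a} {b} a≤b =
    subst₂ _≤_ (sym (⊓-increment-clamp a tk≤tk+1)) (sym (⊓-increment-clamp b tk≤tk+1))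
      (+-monoˡ-≤ (- t P k) (⊔-monoˡ-≤ (t P k) (⊓-monoˡ-≤ (t P (suc k)) a≤b)))
    where
    tk≤tk+1 : t P k ≤ t P (suc k)
    tk≤tk+1 = <⇒≤ (t-incr P k)

  covered-past : ∀ {k T} → T ≤ t P k → covered k T ≡ 0ℚ
  covered-past {k} {T} T≤tk = begin
    T ⊓ t P (suc k) - T ⊓ t P k
      ≡⟨ cong₂ _-_ (p≤q⇒p⊓q≡p (≤-trans T≤tk (<⇒≤ (t-incr P k)))) (p≤q⇒p⊓q≡p T≤tk) ⟩
    T - T
      ≡⟨ +-inverseʳ T ⟩
    0ℚ
      ∎
    where open ≡-Reasoning

  workUpto-stable : ∀ {T k l} → T ≤ t P k → k ≤′ l → workUpto P l T ≡ workUpto P k T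
  workUpto-stable T≤tk ≤′-refl = refl
  workUpto-stable {T} {k} T≤tk (≤′-step {l} k≤l) = begin
    workUpto P l T + e P l * covered l T  ≡⟨ cong (λ c → workUpto P l T + e P l * c) (covered-past T≤tl) ⟩
    workUpto P l T + e P l * 0ℚ           ≡⟨ trans (cong (workUpto P l T +_) (*-zeroʳ (e P l))) (+-identityʳ _) ⟩
    workUpto P l T                        ≡⟨ workUpto-stable T≤tk k≤l ⟩
    workUpto P k T                        ∎
    where
    open ≡-Reasoning
    T≤tl : T ≤ t P l
    T≤tl = ≤-trans T≤tk (t-mono k≤l)

  workUpto-agree : ∀ {T k l} → T ≤ t P k → T ≤ t P l → workUpto P k T ≡ workUpto P l T
  workUpto-agree {k = k} {l} T≤tk T≤tl with ℕ.≤-total k l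
  ... | inj₁ k≤l = sym (workUpto-stable T≤tk (ℕ.≤⇒≤′ k≤l))
  ... | inj₂ l≤k = workUpto-stable T≤tl (ℕ.≤⇒≤′ l≤k)

  workUpto-gain : ∀ {lo a b} → (∀ k → lo ≤ e P k) → 0ℚ ≤ a → a ≤ b → ∀ K →
                  workUpto P K a + lo * (b ⊓ t P K - a ⊓ t P K) ≤ workUpto P K b
  workUpto-gain {lo} {a} {b} lo≤e 0≤a a≤b zero = ≤-reflexive (begin
    0ℚ + lo * (b ⊓ t P 0 - a ⊓ t P 0)
      ≡⟨ cong (λ d → 0ℚ + lo * d) (cong₂ _-_ (⊓-t0 (≤-trans 0≤a a≤b)) (⊓-t0 0≤a)) ⟩
    0ℚ + lo * 0ℚ
      ≡⟨ trans (+-identityˡ _) (*-zeroʳ lo) ⟩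
    0ℚ
      ∎)
    where
    open ≡-Reasoning
    ⊓-t0 : ∀ {T} → 0ℚ ≤ T → T ⊓ t P 0 ≡ 0ℚ
    ⊓-t0 {T} 0≤T = trans (cong (T ⊓_) (t0 P)) (p≥q⇒p⊓q≡q 0≤T)
  workUpto-gain {lo} {a} {b} lo≤e 0≤a a≤b (suc K) = begin
    (workUpto P K a + e P K * covered K a) + lo * (B′ - A′)
      ≡⟨ regroup (workUpto P K a) (e P K) lo A A′ B B′ ⟩
    (workUpto P K a + lo * (B - A)) + (e P K * covered K a + lo * δ)
      ≤⟨ +-mono-≤ (workUpto-gain lo≤e 0≤a a≤b K) (+-monoʳ-≤ (e P K * covered K a) lo*δ≤e*δ) ⟩
    workUpto P K b + (e P K * covered K a + e P K * δ)
      ≡⟨ cong (workUpto P K b +_) (collect (e P K) (covered K a) (covered K b)) ⟩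
    workUpto P K b + e P K * covered K b
      ∎
    where
    open ≤-Reasoning
    A A′ B B′ δ : ℚ
    A  = a ⊓ t P K
    A′ = a ⊓ t P (suc K)
    B  = b ⊓ t P K
    B′ = b ⊓ t P (suc K)
    δ  = covered K b - covered K a
    lo*δ≤e*δ : lo * δ ≤ e P K * δ
    lo*δ≤e*δ = *-monoʳ-≤-nonNeg δ {{nonNegative (p≤q⇒0≤q-p (covered-mono K a≤b))}} (lo≤e K)
    regroup : ∀ w e l A A′ B B′ → (w + e * (A′ - A)) + l * (B′ - A′) ≡
                                  (w + l * (B - A)) + (e * (A′ - A) + l * ((B′ - B) - (A′ - A)))
    regroup = solve-∀ ℚ-ring
    collect : ∀ e x y → e * x + e * (y - x) ≡ e * y
    collect = solve-∀ ℚ-ring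

  workUpto-≤ : ∀ {T} → 0ℚ ≤ T → ∀ K → workUpto P K T ≤ T ⊓ t P K
  workUpto-≤ 0≤T zero = ⊓-glb 0≤T (0≤t 0)
  workUpto-≤ {T} 0≤T (suc K) = begin
    workUpto P K T + e P K * covered K T  ≤⟨ +-mono-≤ (workUpto-≤ 0≤T K) e*covered≤covered ⟩
    T ⊓ t P K + covered K T               ≡⟨ telescope (T ⊓ t P K) (T ⊓ t P (suc K)) ⟩
    T ⊓ t P (suc K)                       ∎
    where
    open ≤-Reasoning
    0≤covered : 0ℚ ≤ covered K T
    0≤covered = p≤q⇒0≤q-p (⊓-monoʳ-≤ T (<⇒≤ (t-incr P K)))
    e*covered≤covered : e P K * covered K T ≤ covered K T
    e*covered≤covered = subst (e P K * covered K T ≤_) (*-identityˡ (covered K T))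
                          (*-monoʳ-≤-nonNeg (covered K T) {{nonNegative 0≤covered}} (e-le1 P K))
    telescope : ∀ x y → x + (y - x) ≡ y
    telescope = solve-∀ ℚ-ring

  processed : ℚ → ℚ
  processed T = workUpto P (proj₁ (t-unbdd P T)) T

  processed-workUpto : ∀ {T k} → T ≤ t P k → processed T ≡ workUpto P k T
  processed-workUpto {T} = workUpto-agree (<⇒≤ (proj₂ (t-unbdd P T)))

  processed-zero : processed 0ℚ ≡ 0ℚ
  processed-zero = processed-workUpto (0≤t 0)

  processed-Work : ∀ {T w} → Work P T w → processed T ≡ w
  processed-Work (k , T≤tk , workUpto≡w) = trans (processed-workUpto T≤tk) workUpto≡w

  processed-Completes : ∀ {s q C} → Completes P s q C → processed C ≡ processed s + q
  processed-Completes {q = q} (_ , _ , _ , work-s , work-C , wC≡ws+q , _) =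
    trans (processed-Work work-C) (trans wC≡ws+q (cong (_+ q) (sym (processed-Work work-s))))

  processed-gain : ∀ {lo a b} → (∀ k → lo ≤ e P k) → 0ℚ ≤ a → a ≤ b →
                   processed a + lo * (b - a) ≤ processed b
  processed-gain {lo} {a} {b} lo≤e 0≤a a≤b =
    subst₂ _≤_ (cong₂ _+_ (sym (processed-workUpto a≤tK)) (cong (lo *_) gap≡b-a))
               (sym (processed-workUpto b≤tK))
               (workUpto-gain lo≤e 0≤a a≤b K)
    where
    K : ℕ
    K = proj₁ (t-unbdd P b)
    b≤tK : b ≤ t P K
    b≤tK = <⇒≤ (proj₂ (t-unbdd P b))
    a≤tK : a ≤ t P K
    a≤tK = ≤-trans a≤b b≤tK
    gap≡b-a : b ⊓ t P K - a ⊓ t P K ≡ b - a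
    gap≡b-a = cong₂ _-_ (p≤q⇒p⊓q≡p b≤tK) (p≤q⇒p⊓q≡p a≤tK)

  processed-mono : ∀ {a b} → 0ℚ ≤ a → a ≤ b → processed a ≤ processed b
  processed-mono {a} {b} 0≤a a≤b =
    subst (_≤ processed b) (trans (cong (processed a +_) (*-zeroˡ (b - a))) (+-identityʳ (processed a)))
      (processed-gain (λ k → <⇒≤ (e-pos P k)) 0≤a a≤b)

  processed-nonneg : ∀ {T} → 0ℚ ≤ T → 0ℚ ≤ processed T
  processed-nonneg {T} 0≤T = subst (_≤ processed T) processed-zero (processed-mono ≤-refl 0≤T)

  processed-≤ : ∀ {T} → 0ℚ ≤ T → processed T ≤ T
  processed-≤ {T} 0≤T =
    subst (_≤ T) (sym (processed-workUpto T≤tK)) (≤-trans (workUpto-≤ 0≤T K) (p⊓q≤p T (t P K)))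
    where
    K : ℕ
    K = proj₁ (t-unbdd P T)
    T≤tK : T ≤ t P K
    T≤tK = <⇒≤ (proj₂ (t-unbdd P T))

  module _ {n} (p : Fin n → ℚ) where

    runSeq-mono : ∀ {s js F} → RunSeq P p s js F → s ≤ F
    runSeq-mono run-[]                 = ≤-refl
    runSeq-mono (run-∷ completes rest) = ≤-trans (proj₁ completes) (runSeq-mono rest)

    runSeq-processed : ∀ {s js F} → RunSeq P p s js F →
                       processed F ≡ processed s + listSum (map p js)
    runSeq-processed {s} run-[] = sym (+-identityʳ (processed s))
    runSeq-processed {s} (run-∷ {c = c} {F} {j} {js} completes rest) = begin
      processed F                                  ≡⟨ runSeq-processed rest ⟩
      processed c + listSum (map p js)             ≡⟨ cong (_+ listSum (map p js)) (processed-Completes completes) ⟩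
      (processed s + p j) + listSum (map p js)     ≡⟨ +-assoc (processed s) (p j) _ ⟩
      processed s + (p j + listSum (map p js))     ∎
      where open ≡-Reasoning

open WorkFunction

workDone : ∀ {m} → (Fin m → Profile) → (Fin m → ℚ) → ℚ
workDone P F = sum (λ i → processed (P i) (F i))

module FeasibleSchedule {m n} (P : Fin m → Profile) (p : Fin n → ℚ) (p-pos : ∀ j → 0ℚ < p j)
  {σ : Fin m → List (Fin n)} (schedule : IsSchedule σ)
  {G : Fin m → ℚ} (runs : ∀ i → RunSeq (P i) p 0ℚ (σ i) (G i)) where

  processed-finish : ∀ i → processed (P i) (G i) ≡ listSum (map p (σ i))
  processed-finish i =
    trans (runSeq-processed (P i) p (runs i)) (trans (cong (_+ _) (processed-zero (P i))) (+-identityˡ _))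

  0≤finish : ∀ i → 0ℚ ≤ G i
  0≤finish i = runSeq-mono (P i) p (runs i)

  job-≤-makespan : ∀ j → p j ≤ maxOver G
  job-≤-makespan j with i , j∈σi ← ∈-schedule schedule j = begin
    p j                      ≤⟨ ∈⇒≤-listSum p (<⇒≤ ∘ p-pos) j∈σi ⟩
    listSum (map p (σ i))    ≡⟨ processed-finish i ⟨
    processed (P i) (G i)    ≤⟨ processed-≤ (P i) (0≤finish i) ⟩
    G i                      ≤⟨ maxOver-ub G i ⟩
    maxOver G                ∎
    where open ≤-Reasoning

  jobs-≤-capacity : ∀ {L} → L ↭ allFin n → listSum (map p L) ≤ workDone P (λ _ → maxOver G)
  jobs-≤-capacity {L} L↭ = begin
    listSum (map p L)                            ≡⟨ listSum-↭ (map⁺ p (↭-trans L↭ (↭-sym schedule))) ⟩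
    listSum (map p (concat (map σ (allFin m))))  ≡⟨ cong (listSum ∘ map p ∘ concat) (map-tabulate (λ i → i) σ) ⟩
    listSum (map p (concat (tabulate σ)))        ≡⟨ listSum-map-concat p σ ⟩
    sum (λ i → listSum (map p (σ i)))            ≡⟨ sum-cong-≗ processed-finish ⟨
    workDone P G                                 ≤⟨ sum-mono (λ i → processed-mono (P i) (0≤finish i) (maxOver-ub G i)) ⟩
    workDone P (λ _ → maxOver G)                 ∎
    where open ≤-Reasoning

module LSECTAnalysis {m n} (P : Fin m → Profile) (p : Fin n → ℚ) (p-pos : ∀ j → 0ℚ < p j)
  {m1} (m1≤m : m1 ℕ.≤ m) {e0} (0≤e0 : 0ℚ ≤ e0)
  (fast : ∀ (i : Fin m) k → toℕ i ℕ.< m1 → e0 ≤ e (P i) k)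
  {K} (m≤m1*K : m ℕ.≤ m1 ℕ.* K)
  {D X} (0≤D : 0ℚ ≤ D) (p≤D : ∀ j → p j ≤ D) (D≤X : D ≤ X) (K×D≤gain : K × D ≤ e0 * (X - D)) where

  capacity : ℚ
  capacity = workDone P (λ _ → D)

  late⇒saturated : ∀ {F c : Fin m → ℚ} {j} → (∀ i → 0ℚ ≤ F i) →
                   (∀ i → Completes (P i) (F i) (p j) (c i)) → (∀ i → X ≤ c i) →
                   capacity ≤ workDone P F
  late⇒saturated {F} {c} {j} 0≤F completes X≤c = +-cancelʳ-≤ (m × D) (begin
    capacity + m × D                          ≤⟨ +-monoʳ-≤ capacity m×D≤m1×K×D ⟩
    capacity + m1 × (K × D)                   ≤⟨ sum-count m1 m1≤m slack fast-slack ⟩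
    sum (λ i → processed (P i) (F i) + D)     ≡⟨ ∑-distrib-+ (λ i → processed (P i) (F i)) (λ _ → D) ⟩
    workDone P F + sum {m} (λ _ → D)          ≡⟨ cong (workDone P F +_) (sum-replicate m) ⟩
    workDone P F + m × D                      ∎)
    where
    open ≤-Reasoning
    m×D≤m1×K×D : m × D ≤ m1 × (K × D)
    m×D≤m1×K×D = subst (m × D ≤_) (sym (×-assocˡ D m1 K)) (×-monoˡ-≤ m≤m1*K 0≤D)
    slack : ∀ i → processed (P i) D ≤ processed (P i) (F i) + D
    slack i = ≤-trans (processed-≤ (P i) 0≤D) (x≤y+x D (processed-nonneg (P i) (0≤F i)))
    fast-slack : ∀ i → toℕ i ℕ.< m1 → processed (P i) D + K × D ≤ processed (P i) (F i) + D
    fast-slack i i-fast = begin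
      processed (P i) D + K × D             ≤⟨ +-monoʳ-≤ (processed (P i) D) (≤-trans K×D≤gain gain≤) ⟩
      processed (P i) D + e0 * (c i - D)    ≤⟨ processed-gain (P i) (λ k → fast i k i-fast) 0≤D (≤-trans D≤X (X≤c i)) ⟩
      processed (P i) (c i)                 ≡⟨ processed-Completes (P i) (completes i) ⟩
      processed (P i) (F i) + p j           ≤⟨ +-monoʳ-≤ (processed (P i) (F i)) (p≤D j) ⟩
      processed (P i) (F i) + D             ∎
      where
      gain≤ : e0 * (X - D) ≤ e0 * (c i - D)
      gain≤ = *-monoˡ-≤-nonNeg e0 {{nonNegative 0≤e0}} (+-monoˡ-≤ (- D) (X≤c i))

  assigned-≤ : ∀ {F c : Fin m → ℚ} {j i₀} → (∀ i → 0ℚ ≤ F i) →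
               (∀ i → Completes (P i) (F i) (p j) (c i)) → (∀ i → c i₀ ≤ c i) →
               workDone P F + p j ≤ capacity → c i₀ ≤ X
  assigned-≤ {F} {j = j} 0≤F completes c-min budget = ≮⇒≥ λ X<ci₀ → <-irrefl refl (begin-strict
    workDone P F        <⟨ x<x+y (workDone P F) (p-pos j) ⟩
    workDone P F + p j  ≤⟨ budget ⟩
    capacity            ≤⟨ late⇒saturated 0≤F completes (λ i → ≤-trans (<⇒≤ X<ci₀) (c-min i)) ⟩
    workDone P F        ∎)
    where open ≤-Reasoning

  workDone-update : ∀ {F i x j} → Completes (P i) (F i) (p j) x →
                    workDone P (update F i x) ≡ workDone P F + p j
  workDone-update {F} {i} {x} completes =
    sum-bump i (trans (cong (processed (P i)) (update-≡ F i x)) (processed-Completes (P i) completes))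
               (λ i′ i′≢i → cong (processed (P i′)) (update-≢ F i x i′≢i))

  lsect-≤ : ∀ {F L F′} → LSECT P p F L F′ → (∀ i → 0ℚ ≤ F i) → (∀ i → F i ≤ X) →
            workDone P F + listSum (map p L) ≤ capacity → ∀ i → F′ i ≤ X
  lsect-≤ ls-[] _ F≤X _ = F≤X
  lsect-≤ {F} (ls-∷ {j = j} {js} c completes i c-min rest) 0≤F F≤X budget =
    lsect-≤ rest (update-pointwise F i (c i) (0ℚ ≤_) 0≤ci 0≤F)
                 (update-pointwise F i (c i) (_≤ X) ci≤X F≤X)
                 budget′
    where
    budget-j : workDone P F + p j + listSum (map p js) ≤ capacity
    budget-j = subst (_≤ capacity) (sym (+-assoc (workDone P F) (p j) _)) budget
    0≤ci : 0ℚ ≤ c i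
    0≤ci = ≤-trans (0≤F i) (proj₁ (completes i))
    ci≤X : c i ≤ X
    ci≤X = assigned-≤ 0≤F completes c-min
             (≤-trans (x≤x+y _ (listSum-nonneg p (<⇒≤ ∘ p-pos) js)) budget-j)
    budget′ : workDone P (update F i (c i)) + listSum (map p js) ≤ capacity
    budget′ = subst (λ w → w + listSum (map p js) ≤ capacity)
                    (sym (workDone-update (completes i))) budget-j

module Stretch {e0 : ℚ} (0<e0 : 0ℚ < e0) (k : ℕ) {D : ℚ} (0≤D : 0ℚ ≤ D) where

  private instance
    e0-positive : Positive e0
    e0-positive = positive 0<e0
    e0-nonZero : NonZero e0
    e0-nonZero = pos⇒nonZero e0

  stretched : ℚ
  stretched = (1ℚ + 1/ e0 * ℕtoℚ k) * D

  stretched≡D+[k×D]/e0 : stretched ≡ D + 1/ e0 * (k × D)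
  stretched≡D+[k×D]/e0 = trans (expand (1/ e0) (ℕtoℚ k) D) (cong (λ y → D + 1/ e0 * y) (ℕtoℚ*≡× k D))
    where
    expand : ∀ a c d → (1ℚ + a * c) * d ≡ d + a * (c * d)
    expand = solve-∀ ℚ-ring

  D≤stretched : D ≤ stretched
  D≤stretched = subst (D ≤_) (sym stretched≡D+[k×D]/e0) (x≤x+y D 0≤[k×D]/e0)
    where
    0≤[k×D]/e0 : 0ℚ ≤ 1/ e0 * (k × D)
    0≤[k×D]/e0 = subst (_≤ 1/ e0 * (k × D)) (*-zeroʳ (1/ e0))
                   (*-monoˡ-≤-nonNeg (1/ e0) {{pos⇒nonNeg (1/ e0) {{1/pos⇒pos e0}}}} (×-nonneg k 0≤D))

  e0*[stretched-D]≡k×D : e0 * (stretched - D) ≡ k × D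
  e0*[stretched-D]≡k×D = begin
    e0 * (stretched - D)                ≡⟨ cong (λ x → e0 * (x - D)) stretched≡D+[k×D]/e0 ⟩
    e0 * (D + 1/ e0 * (k × D) - D)      ≡⟨ reassociate e0 (1/ e0) D (k × D) ⟩
    (e0 * 1/ e0) * (k × D)              ≡⟨ trans (cong (_* (k × D)) (*-inverseʳ e0)) (*-identityˡ (k × D)) ⟩
    k × D                               ∎
    where
    open ≡-Reasoning
    reassociate : ∀ e a d y → e * (d + a * y - d) ≡ (e * a) * y
    reassociate = solve-∀ ℚ-ring

theorem3 : (e0 : ℚ) (e0-pos : 0ℚ < e0) → e0 ≤ 1ℚ →
    (m m1 : ℕ) (m1≥1 : 1 ℕ.≤ m1) → m1 ℕ.≤ m ℕ.∸ 1 →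
    (n : ℕ) (p : Fin n → ℚ) → (∀ j → 0ℚ < p j) →
    (P : Fin m → Profile) →
    (∀ (i : Fin m) (k : ℕ) → toℕ i ℕ.< m1 → e0 ≤ e (P i) k) →
    (L : List (Fin n)) → L ↭ allFin n →
    (F : Fin m → ℚ) → LSECT P p (λ _ → 0ℚ) L F →
    (σ : Fin m → List (Fin n)) → IsSchedule σ →
    (G : Fin m → ℚ) → (∀ i → RunSeq (P i) p 0ℚ (σ i) (G i)) →
    maxOver F ≤ bound e0 {{pos⇒nonZero e0 {{positive e0-pos}}}} m m1 {{ℕ.>-nonZero m1≥1}} * maxOver G
theorem3 e0 0<e0 _ m m1 1≤m1 m1≤m∸1 n p p-pos P fast L L↭ F lsect σ schedule G runs =
  maxOver-lub F 0≤X (lsect-≤ lsect (λ _ → ≤-refl) (λ _ → 0≤X) initial-budget)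
  where
  instance
    m1-nonZero : ℕ.NonZero m1
    m1-nonZero = ℕ.>-nonZero 1≤m1
  K : ℕ
  K = (m ℕ.∸ 1) ℕ./ m1 ℕ.+ 1
  0≤D : 0ℚ ≤ maxOver G
  0≤D = maxOver-nonneg G
  open Stretch 0<e0 K 0≤D
  0≤X : 0ℚ ≤ stretched
  0≤X = ≤-trans 0≤D D≤stretched
  open FeasibleSchedule P p p-pos schedule runs
  open LSECTAnalysis P p p-pos (ℕ.≤-trans m1≤m∸1 (ℕ.m∸n≤m m 1)) (<⇒≤ 0<e0) fast (m≤n*[[m∸1]/n+1] m m1)
                     0≤D job-≤-makespan D≤stretched (≤-reflexive (sym e0*[stretched-D]≡k×D))
  initial-budget : workDone P (λ _ → 0ℚ) + listSum (map p L) ≤ capacity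
  initial-budget = subst (_≤ capacity) (sym (trans (cong (_+ _) idle) (+-identityˡ _))) (jobs-≤-capacity L↭)
    where
    idle : workDone P (λ _ → 0ℚ) ≡ 0ℚ
    idle = trans (sum-cong-≗ (λ i → processed-zero (P i))) (sum-replicate-zero m)
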